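{- Let $a,b$ be integers with $a-1>b\ge 1$, let $\varphi(0)=0^a1$, $\varphi(1)=0^b1$ define a morphism of $\{0,1\}^*$, and let $u_\beta=\lim_{n\to\infty}\varphi^n(0)$. Let $p$ be a palindrome in ${\cal L}(u_\beta)$ containing at least one letter $1$. Then $p$ is a central factor of a palindrome in ${\cal L}(u_\beta)$ having the prefix $0^b1$ (equivalently, the suffix $10^b$).
   Context: ${\cal L}(u_\beta)$ is the set of finite factors of $u_\beta$. For a word $w=w_1\cdots w_n$, $\overline{w}=w_n\cdots w_1$; $w$ is a palindrome if $w=\overline{w}$. A palindrome $p$ is a central factor of a palindrome $q$ if there is a finite word $w\in{\cal L}(u_\beta)$ with $q=wp\overline{w}$. -}

module Defs where

open import Data.Nat using (ℕ; zero; suc; _+_; _<_)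
open import Data.List using (List; []; _∷_; _++_; replicate; concatMap; length; reverse)
open import Data.Product using (Σ; ∃; _×_; _,_)
open import Relation.Binary.PropositionalEquality using (_≡_)

data Letter : Set where
  𝟎 𝟏 : Letter

Word : Set
Word = List Letter

φ-letter : ℕ → ℕ → Letter → Word
φ-letter a b 𝟎 = replicate a 𝟎 ++ (𝟏 ∷ [])
φ-letter a b 𝟏 = replicate b 𝟎 ++ (𝟏 ∷ [])

φ : ℕ → ℕ → Word → Word
φ a b = concatMap (φ-letter a b)

φ^ : ℕ → ℕ → ℕ → Word → Word
φ^ a b zero    w = w
φ^ a b (suc n) w = φ a b (φ^ a b n w)

-- i-th letter of a finite word (default 𝟎 if out of range; never used
-- out of range for u below).
nth : Word → ℕ → Letter
nth []      _       = 𝟎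
nth (x ∷ w) zero    = x
nth (x ∷ w) (suc i) = nth w i

-- u_β = lim φ^n(0) as an infinite word ℕ → Letter.  Since φ(0) starts
-- with 0, φ^n(0) is a prefix of φ^(n+1)(0), and |φ^(i+1)(0)| > i (as a ≥ 1),
-- so the i-th letter of the limit is the i-th letter of φ^(i+1)(0).
u : ℕ → ℕ → ℕ → Letter
u a b i = nth (φ^ a b (suc i) (𝟎 ∷ [])) i

OccursAt : (ℕ → Letter) → Word → ℕ → Set
OccursAt x w i = (j : ℕ) → j < length w → nth w j ≡ x (i + j)

InLang : ℕ → ℕ → Word → Set
InLang a b w = ∃ λ i → OccursAt (u a b) w i

Palindrome : Word → Set
Palindrome w = reverse w ≡ w

CentralFactor : ℕ → ℕ → Word → Word → Set
CentralFactor a b p q = ∃ λ w → InLang a b w × q ≡ w ++ p ++ reverse w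

Prefix : Word → Word → Set
Prefix v q = ∃ λ r → q ≡ v ++ r

{-# OPTIONS --safe #-}
-- Cutting a prefix φ(φⁿ(0)) of u_β after its letters 1, which end the blocks
-- φ(0) = 0^a 1 and φ(1) = 0^b 1, shows that a palindromic factor containing 1 is
-- 0^k 1 φ(t) 0^k, where t is a palindromic factor of φⁿ(0) (φ is injective and
-- reverse(φ(t)) 1 = 1 φ(reverse t)), k ≤ a, and 0t0 is a factor when k > b.
-- Applying φ to a factor w extended by a letter on each side puts 1 φ(w) 0^b in the
-- language; for w = 1t or w = 0t0 this yields 1 0^j 1 φ(t) 0^j with j = b or j = a,
-- j ≥ k, so by induction on n every palindromic factor r occurs as 1 0^m r 0^m.
-- The required palindrome is 0^b 1 φ(t) 0^b when k ≤ b.  When k > b it is the image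
-- 0^b 1 φ(0^m 0t0 0^m) 0^b of such an occurrence of 0t0, whose centre is 0^a 1 φ(t) 0^a.
module Submission where

open import Defs
open import Data.Nat using (ℕ; zero; suc; _+_; _∸_; _<_; _≤_; z≤n; s≤s; _≤?_)
open import Data.Nat.Properties
  using (≤-refl; ≤-trans; <-≤-trans; <-irrefl; <⇒≤; <⇒≢; ≰⇒>; n≤1+n; +-comm; m≤m+n; m≤n+m;
         m+[n∸m]≡n; m∸n+n≡m; +-mono-≤; +-monoʳ-≤; +-monoʳ-<; module ≤-Reasoning)
open import Data.List using ([]; _∷_; _++_; [_]; replicate; length; reverse)
open import Data.List.Properties
  using (++-assoc; ++-identityʳ; ++-cancelʳ; reverse-++; unfold-reverse; reverse-involutive;
         length-++; ∷-injective; concatMap-++; ++-monoid)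
open import Data.List.Membership.Propositional using (_∈_)
open import Data.List.Membership.Propositional.Properties using (∈-++⁺ˡ; ∈-++⁺ʳ)
open import Data.List.Relation.Unary.Any using (here; there)
open import Data.Product using (∃; ∃₂; _×_; _,_; proj₂)
open import Data.Empty using (⊥; ⊥-elim)
open import Relation.Nullary using (yes; no)
open import Relation.Binary.PropositionalEquality
  using (_≡_; _≢_; refl; sym; trans; cong; cong₂; subst; module ≡-Reasoning)
open import Algebra.Solver.Monoid (++-monoid Letter) using (solve; _⊕_; _⊜_)

infix 10 𝟎^_

𝟎^_ : ℕ → Word
𝟎^ n = replicate n 𝟎

𝟎^-+ : ∀ m n → 𝟎^ m ++ 𝟎^ n ≡ 𝟎^ (m + n)
𝟎^-+ zero    n = refl
𝟎^-+ (suc m) n = cong (𝟎 ∷_) (𝟎^-+ m n)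

𝟎^-suc : ∀ n → 𝟎^ suc n ≡ 𝟎^ n ++ [ 𝟎 ]
𝟎^-suc zero    = refl
𝟎^-suc (suc n) = cong (𝟎 ∷_) (𝟎^-suc n)

reverse-𝟎^ : ∀ n → reverse (𝟎^ n) ≡ 𝟎^ n
reverse-𝟎^ zero    = refl
reverse-𝟎^ (suc n) = begin
  reverse (𝟎 ∷ 𝟎^ n)      ≡⟨ unfold-reverse 𝟎 (𝟎^ n) ⟩
  reverse (𝟎^ n) ++ [ 𝟎 ] ≡⟨ cong (_++ [ 𝟎 ]) (reverse-𝟎^ n) ⟩
  𝟎^ n ++ [ 𝟎 ]           ≡⟨ 𝟎^-suc n ⟨
  𝟎^ suc n                ∎
  where open ≡-Reasoning

𝟏∉𝟎^ : ∀ n → 𝟏 ∈ 𝟎^ n → ⊥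
𝟏∉𝟎^ (suc n) (there 𝟏∈) = 𝟏∉𝟎^ n 𝟏∈

𝟎^-𝟏≢[] : ∀ n X → 𝟎^ n ++ 𝟏 ∷ X ≢ []
𝟎^-𝟏≢[] zero    X ()
𝟎^-𝟏≢[] (suc n) X ()

𝟎^-𝟏-injective : ∀ {k j X Y} → 𝟎^ k ++ 𝟏 ∷ X ≡ 𝟎^ j ++ 𝟏 ∷ Y → k ≡ j × X ≡ Y
𝟎^-𝟏-injective {zero}  {zero}  refl = refl , refl
𝟎^-𝟏-injective {suc k} {suc j} eq with 𝟎^-𝟏-injective (proj₂ (∷-injective eq))
... | refl , X≡Y = refl , X≡Y

𝟎^-prefix-≤ : ∀ {k n X Y} → 𝟎^ k ++ X ≡ 𝟎^ n ++ 𝟏 ∷ Y → k ≤ n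
𝟎^-prefix-≤ {zero}          _  = z≤n
𝟎^-prefix-≤ {suc k} {suc n} eq = s≤s (𝟎^-prefix-≤ (proj₂ (∷-injective eq)))

merge-zeros : ∀ s l k X → (s ++ 𝟎^ l) ++ 𝟎^ k ++ X ≡ s ++ 𝟎^ (l + k) ++ X
merge-zeros s l k X = trans (++-assoc s (𝟎^ l) _)
  (cong (s ++_) (trans (sym (++-assoc (𝟎^ l) (𝟎^ k) X)) (cong (_++ X) (𝟎^-+ l k))))

𝟎^-split : ∀ {i j} → i ≤ j → 𝟎^ j ≡ 𝟎^ i ++ 𝟎^ (j ∸ i)
𝟎^-split {i} {j} i≤j = trans (cong 𝟎^_ (sym (m+[n∸m]≡n i≤j))) (sym (𝟎^-+ i (j ∸ i)))

𝟎^-wrap : ∀ {k j} X → k ≤ j →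
          𝟎^ j ++ X ++ 𝟎^ j ≡ 𝟎^ (j ∸ k) ++ (𝟎^ k ++ X ++ 𝟎^ k) ++ 𝟎^ (j ∸ k)
𝟎^-wrap {k} {j} X k≤j = begin
  𝟎^ j ++ X ++ 𝟎^ j                          ≡⟨ cong₂ (λ l r → l ++ X ++ r) left (𝟎^-split k≤j) ⟩
  (D ++ 𝟎^ k) ++ X ++ (𝟎^ k ++ D)            ≡⟨ solve 3 (λ D Z X → (D ⊕ Z) ⊕ (X ⊕ (Z ⊕ D)) ⊜ D ⊕ ((Z ⊕ (X ⊕ Z)) ⊕ D)) refl D (𝟎^ k) X ⟩
  D ++ (𝟎^ k ++ X ++ 𝟎^ k) ++ D              ∎
  where
  open ≡-Reasoning
  D = 𝟎^ (j ∸ k)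
  left : 𝟎^ j ≡ D ++ 𝟎^ k
  left = trans (cong 𝟎^_ (sym (m∸n+n≡m k≤j))) (sym (𝟎^-+ (j ∸ k) k))

data LeadingZeros : Word → Set where
  all-zeros : ∀ i → LeadingZeros (𝟎^ i)
  zeros-𝟏   : ∀ i X → LeadingZeros (𝟎^ i ++ 𝟏 ∷ X)

leadingZeros : ∀ X → LeadingZeros X
leadingZeros []      = all-zeros 0
leadingZeros (𝟏 ∷ X) = zeros-𝟏 0 X
leadingZeros (𝟎 ∷ X) with leadingZeros X
... | all-zeros i  = all-zeros (suc i)
... | zeros-𝟏 i X′ = zeros-𝟏 (suc i) X′

data Ends𝟏OrEmpty : Word → Set where
  empty : Ends𝟏OrEmpty []
  ends𝟏 : ∀ s → Ends𝟏OrEmpty (s ++ [ 𝟏 ])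

data TrailingZeros : Word → Set where
  _·𝟎^_ : ∀ {s} → Ends𝟏OrEmpty s → ∀ j → TrailingZeros (s ++ 𝟎^ j)

trailingZeros : ∀ X → TrailingZeros X
trailingZeros []      = empty ·𝟎^ 0
trailingZeros (𝟎 ∷ X) with trailingZeros X
... | empty ·𝟎^ j   = empty ·𝟎^ suc j
... | ends𝟏 s ·𝟎^ j = ends𝟏 (𝟎 ∷ s) ·𝟎^ j
trailingZeros (𝟏 ∷ X) with trailingZeros X
... | empty ·𝟎^ j   = ends𝟏 [] ·𝟎^ j
... | ends𝟏 s ·𝟎^ j = ends𝟏 (𝟏 ∷ s) ·𝟎^ j

∷-∷ʳ-view : ∀ (x : Letter) X → ∃₂ λ X′ y → x ∷ X ≡ X′ ++ [ y ]
∷-∷ʳ-view x []       = [] , x , refl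
∷-∷ʳ-view x (x′ ∷ X) with ∷-∷ʳ-view x′ X
... | X′ , y , eq = x ∷ X′ , y , cong (x ∷_) eq

infix 4 _⊑_

_⊑_ : Word → Word → Set
w ⊑ W = ∃₂ λ L R → W ≡ L ++ w ++ R

⊑-trans : ∀ {u v w} → u ⊑ v → v ⊑ w → u ⊑ w
⊑-trans {u} (L , R , refl) (L′ , R′ , refl) = L′ ++ L , R ++ R′ ,
  solve 5 (λ L′ L u R R′ → L′ ⊕ ((L ⊕ (u ⊕ R)) ⊕ R′) ⊜ (L′ ⊕ L) ⊕ (u ⊕ (R ⊕ R′))) refl L′ L u R R′

⊑-∷ : ∀ x w → w ⊑ x ∷ w
⊑-∷ x w = [ x ] , [] , cong (x ∷_) (sym (++-identityʳ w))

∈-⊑ : ∀ {x w W} → x ∈ w → w ⊑ W → x ∈ W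
∈-⊑ x∈w (L , R , refl) = ∈-++⁺ʳ L (∈-++⁺ˡ x∈w)

left-neighbour : ∀ (x : Letter) X w d Z → ∃ λ c → c ∷ w ++ [ d ] ⊑ (x ∷ X) ++ w ++ d ∷ Z
left-neighbour x X w d Z with ∷-∷ʳ-view x X
... | X′ , c , eq = c , X′ , Z , trans (cong (_++ w ++ d ∷ Z) eq)
  (solve 5 (λ X′ c w d Z → (X′ ⊕ c) ⊕ (w ⊕ (d ⊕ Z)) ⊜ X′ ⊕ ((c ⊕ (w ⊕ d)) ⊕ Z)) refl X′ [ c ] w [ d ] Z)

inner-⊑ : ∀ (x : Letter) X w Y y Z → ∃₂ λ c d → c ∷ w ++ [ d ] ⊑ (x ∷ X) ++ w ++ Y ++ y ∷ Z
inner-⊑ x X w []      y Z with left-neighbour x X w y Z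
... | c , occ = c , y , occ
inner-⊑ x X w (d ∷ Y) y Z with left-neighbour x X w d (Y ++ y ∷ Z)
... | c , occ = c , d , occ

nth-++ˡ : ∀ A B {i} → i < length A → nth (A ++ B) i ≡ nth A i
nth-++ˡ (x ∷ A) B {zero}  _         = refl
nth-++ˡ (x ∷ A) B {suc i} (s≤s i<) = nth-++ˡ A B i<

nth-++ʳ : ∀ A B j → nth (A ++ B) (length A + j) ≡ nth B j
nth-++ʳ []      B j = refl
nth-++ʳ (x ∷ A) B j = nth-++ʳ A B j

nth-prefix : ∀ {v q i} → i < length v → Prefix v q → nth q i ≡ nth v i
nth-prefix {v} i< (S , refl) = nth-++ˡ v S i<

prefix-trans : ∀ {u v w} → Prefix u v → Prefix v w → Prefix u w
prefix-trans {u} (S , refl) (S′ , refl) = S ++ S′ , ++-assoc u S S′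

occurs⇒prefix : ∀ W w → length w ≤ length W → (∀ j → j < length w → nth w j ≡ nth W j) → Prefix w W
occurs⇒prefix W       []      _         _    = W , refl
occurs⇒prefix (y ∷ W) (x ∷ w) (s≤s ≤W) same with occurs⇒prefix W w ≤W (λ j j< → same (suc j) (s≤s j<))
... | R , W≡ = R , cong₂ _∷_ (sym (same 0 (s≤s z≤n))) W≡

occurs⇒⊑ : ∀ W i w → i + length w ≤ length W → (∀ j → j < length w → nth w j ≡ nth W (i + j)) → w ⊑ W
occurs⇒⊑ W       zero    w fits same = [] , occurs⇒prefix W w fits same
occurs⇒⊑ (y ∷ W) (suc i) w (s≤s fits) same with occurs⇒⊑ W i w fits same
... | L , R , W≡ = y ∷ L , R , cong (y ∷_) W≡

⊑⇒occurs : ∀ L w R {j} → j < length w →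
           nth w j ≡ nth (L ++ w ++ R) (length L + j) × length L + j < length (L ++ w ++ R)
⊑⇒occurs L w R {j} j< = same , bound
  where
  same : nth w j ≡ nth (L ++ w ++ R) (length L + j)
  same = trans (sym (nth-++ˡ w R j<)) (sym (nth-++ʳ L (w ++ R) j))
  bound : length L + j < length (L ++ w ++ R)
  bound = subst (length L + j <_) (sym (length-++ L))
            (+-monoʳ-< (length L) (<-≤-trans j< (subst (length w ≤_) (sym (length-++ w)) (m≤m+n _ _))))

Central : Word → Word → Set
Central p q = ∃ λ w → q ≡ w ++ p ++ reverse w

central-palindrome : ∀ {p q} → Palindrome p → Central p q → Palindrome q
central-palindrome {p} p-pal (w , refl) = begin
  reverse (w ++ p ++ reverse w)                   ≡⟨ reverse-++ w (p ++ reverse w) ⟩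
  reverse (p ++ reverse w) ++ reverse w           ≡⟨ cong (_++ reverse w) (reverse-++ p (reverse w)) ⟩
  (reverse (reverse w) ++ reverse p) ++ reverse w ≡⟨ cong₂ (λ v p′ → (v ++ p′) ++ reverse w) (reverse-involutive w) p-pal ⟩
  (w ++ p) ++ reverse w                           ≡⟨ ++-assoc w p (reverse w) ⟩
  w ++ p ++ reverse w                             ∎
  where open ≡-Reasoning

central-trans : ∀ {p q r} → Central p q → Central q r → Central p r
central-trans {p} (w , refl) (w′ , refl) = w′ ++ w , (begin
  w′ ++ (w ++ p ++ reverse w) ++ reverse w′     ≡⟨ solve 5 (λ w′ w p v v′ → w′ ⊕ ((w ⊕ (p ⊕ v)) ⊕ v′) ⊜ (w′ ⊕ w) ⊕ (p ⊕ (v ⊕ v′))) refl w′ w p (reverse w) (reverse w′) ⟩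
  (w′ ++ w) ++ p ++ reverse w ++ reverse w′     ≡⟨ cong (λ v → (w′ ++ w) ++ p ++ v) (reverse-++ w′ w) ⟨
  (w′ ++ w) ++ p ++ reverse (w′ ++ w)           ∎)
  where open ≡-Reasoning

central-𝟎^ : ∀ {k j} X → k ≤ j → Central (𝟎^ k ++ X ++ 𝟎^ k) (𝟎^ j ++ X ++ 𝟎^ j)
central-𝟎^ {k} {j} X k≤j = 𝟎^ (j ∸ k) , trans (𝟎^-wrap X k≤j)
  (cong (λ r → 𝟎^ (j ∸ k) ++ (𝟎^ k ++ X ++ 𝟎^ k) ++ r) (sym (reverse-𝟎^ (j ∸ k))))

module Morphism (a b : ℕ) where

  Φ : Word → Word
  Φ = φ a b

  run : Letter → ℕ
  run 𝟎 = a
  run 𝟏 = b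

  Φ-singleton : ∀ x → Φ [ x ] ≡ 𝟎^ run x ++ [ 𝟏 ]
  Φ-singleton 𝟎 = ++-identityʳ _
  Φ-singleton 𝟏 = ++-identityʳ _

  Φ-++ : ∀ X Y → Φ (X ++ Y) ≡ Φ X ++ Φ Y
  Φ-++ = concatMap-++ (φ-letter a b)

  Φ-∷ : ∀ x X → Φ (x ∷ X) ≡ 𝟎^ run x ++ 𝟏 ∷ Φ X
  Φ-∷ x X = begin
    Φ ([ x ] ++ X)              ≡⟨ Φ-++ [ x ] X ⟩
    Φ [ x ] ++ Φ X              ≡⟨ cong (_++ Φ X) (Φ-singleton x) ⟩
    (𝟎^ run x ++ [ 𝟏 ]) ++ Φ X  ≡⟨ ++-assoc (𝟎^ run x) [ 𝟏 ] (Φ X) ⟩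
    𝟎^ run x ++ 𝟏 ∷ Φ X         ∎
    where open ≡-Reasoning

  Φ-⊑ : ∀ {w W} → w ⊑ W → Φ w ⊑ Φ W
  Φ-⊑ {w} (L , R , refl) = Φ L , Φ R , trans (Φ-++ L (w ++ R)) (cong (Φ L ++_) (Φ-++ w R))

  reverse-Φ : ∀ t → reverse (Φ t) ++ [ 𝟏 ] ≡ 𝟏 ∷ Φ (reverse t)
  reverse-Φ []      = refl
  reverse-Φ (x ∷ t) = begin
    reverse (Φ (x ∷ t)) ++ [ 𝟏 ]                   ≡⟨ cong (λ v → reverse v ++ [ 𝟏 ]) (Φ-∷ x t) ⟩
    reverse (𝟎^ n ++ 𝟏 ∷ Φ t) ++ [ 𝟏 ]             ≡⟨ cong (_++ [ 𝟏 ]) (reverse-++ (𝟎^ n) (𝟏 ∷ Φ t)) ⟩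
    (reverse (𝟏 ∷ Φ t) ++ reverse (𝟎^ n)) ++ [ 𝟏 ] ≡⟨ cong₂ (λ v z → (v ++ z) ++ [ 𝟏 ]) (unfold-reverse 𝟏 (Φ t)) (reverse-𝟎^ n) ⟩
    ((reverse (Φ t) ++ [ 𝟏 ]) ++ 𝟎^ n) ++ [ 𝟏 ]    ≡⟨ cong (λ v → (v ++ 𝟎^ n) ++ [ 𝟏 ]) (reverse-Φ t) ⟩
    ((𝟏 ∷ Φ (reverse t)) ++ 𝟎^ n) ++ [ 𝟏 ]         ≡⟨ cong (𝟏 ∷_) (++-assoc (Φ (reverse t)) (𝟎^ n) [ 𝟏 ]) ⟩
    𝟏 ∷ Φ (reverse t) ++ 𝟎^ n ++ [ 𝟏 ]             ≡⟨ cong (λ v → 𝟏 ∷ Φ (reverse t) ++ v) (Φ-singleton x) ⟨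
    𝟏 ∷ Φ (reverse t) ++ Φ [ x ]                   ≡⟨ cong (𝟏 ∷_) (Φ-++ (reverse t) [ x ]) ⟨
    𝟏 ∷ Φ (reverse t ++ [ x ])                     ≡⟨ cong (λ v → 𝟏 ∷ Φ v) (unfold-reverse x t) ⟨
    𝟏 ∷ Φ (reverse (x ∷ t))                        ∎
    where
    open ≡-Reasoning
    n = run x

  framed : ℕ → Word → ℕ → Word
  framed i t j = 𝟎^ i ++ 𝟏 ∷ Φ t ++ 𝟎^ j

  reverse-framed : ∀ i t j → reverse (framed i t j) ≡ framed j (reverse t) i
  reverse-framed i t j = begin
    reverse (𝟎^ i ++ 𝟏 ∷ Φ t ++ 𝟎^ j)                ≡⟨ reverse-++ (𝟎^ i) (𝟏 ∷ Φ t ++ 𝟎^ j) ⟩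
    reverse (𝟏 ∷ Φ t ++ 𝟎^ j) ++ reverse (𝟎^ i)       ≡⟨ cong₂ _++_ (unfold-reverse 𝟏 (Φ t ++ 𝟎^ j)) (reverse-𝟎^ i) ⟩
    (reverse (Φ t ++ 𝟎^ j) ++ [ 𝟏 ]) ++ 𝟎^ i          ≡⟨ cong (λ v → (v ++ [ 𝟏 ]) ++ 𝟎^ i) (reverse-++ (Φ t) (𝟎^ j)) ⟩
    ((reverse (𝟎^ j) ++ reverse (Φ t)) ++ [ 𝟏 ]) ++ 𝟎^ i ≡⟨ cong (λ v → ((v ++ reverse (Φ t)) ++ [ 𝟏 ]) ++ 𝟎^ i) (reverse-𝟎^ j) ⟩
    ((𝟎^ j ++ reverse (Φ t)) ++ [ 𝟏 ]) ++ 𝟎^ i        ≡⟨ solve 4 (λ J T o I → ((J ⊕ T) ⊕ o) ⊕ I ⊜ J ⊕ ((T ⊕ o) ⊕ I)) refl (𝟎^ j) (reverse (Φ t)) [ 𝟏 ] (𝟎^ i) ⟩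
    𝟎^ j ++ (reverse (Φ t) ++ [ 𝟏 ]) ++ 𝟎^ i          ≡⟨ cong (λ v → 𝟎^ j ++ v ++ 𝟎^ i) (reverse-Φ t) ⟩
    𝟎^ j ++ 𝟏 ∷ Φ (reverse t) ++ 𝟎^ i                 ∎
    where open ≡-Reasoning

  Φ-block : ∀ {i Y} C → Φ C ≡ 𝟎^ i ++ 𝟏 ∷ Y → ∃₂ λ x C′ → C ≡ x ∷ C′ × run x ≡ i × Φ C′ ≡ Y
  Φ-block []      eq = ⊥-elim (𝟎^-𝟏≢[] _ _ (sym eq))
  Φ-block (x ∷ C) eq = x , C , refl , 𝟎^-𝟏-injective (trans (sym (Φ-∷ x C)) eq)

  𝟎^-prefix-Φ : ∀ {i X} C → 0 < i → Φ C ≡ 𝟎^ i ++ X → ∃₂ λ x C′ → C ≡ x ∷ C′ × i ≤ run x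
  𝟎^-prefix-Φ {suc i} []      _ ()
  𝟎^-prefix-Φ         (x ∷ C) _ eq = x , C , refl , 𝟎^-prefix-≤ (trans (sym eq) (Φ-∷ x C))

  Φ-cut-after-𝟏 : ∀ Q X {Y} → Φ Q ≡ X ++ 𝟏 ∷ Y →
                  ∃₂ λ A C → Q ≡ A ++ C × Φ A ≡ X ++ [ 𝟏 ] × Φ C ≡ Y
  Φ-cut-after-𝟏 []      []      ()
  Φ-cut-after-𝟏 []      (_ ∷ _) ()
  Φ-cut-after-𝟏 (q ∷ Q) X eq with leadingZeros X
  ... | all-zeros i with 𝟎^-𝟏-injective (trans (sym (Φ-∷ q Q)) eq)
  ...   | refl , ΦQ = [ q ] , Q , refl , Φ-singleton q , ΦQ
  Φ-cut-after-𝟏 (q ∷ Q) X {Y} eq | zeros-𝟏 i X′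
    with 𝟎^-𝟏-injective (trans (sym (Φ-∷ q Q)) (trans eq (++-assoc (𝟎^ i) (𝟏 ∷ X′) (𝟏 ∷ Y))))
  ... | refl , ΦQ with Φ-cut-after-𝟏 Q X′ ΦQ
  ...   | A , C , refl , ΦA , ΦC = q ∷ A , C , refl , ΦqA , ΦC
    where
    ΦqA : Φ (q ∷ A) ≡ (𝟎^ run q ++ 𝟏 ∷ X′) ++ [ 𝟏 ]
    ΦqA = trans (Φ-∷ q A) (trans (cong (λ v → 𝟎^ run q ++ 𝟏 ∷ v) ΦA) (sym (++-assoc (𝟎^ run q) (𝟏 ∷ X′) [ 𝟏 ])))

  Φ-cut : ∀ Q {X Y} → Ends𝟏OrEmpty X → Φ Q ≡ X ++ Y → ∃₂ λ A C → Q ≡ A ++ C × Φ A ≡ X × Φ C ≡ Y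
  Φ-cut Q empty     eq = [] , Q , refl , refl , eq
  Φ-cut Q (ends𝟏 s) eq = Φ-cut-after-𝟏 Q s (trans eq (++-assoc s [ 𝟏 ] _))

  Φ-∷-∷ʳ : ∀ x t y → Φ (x ∷ t ++ [ y ]) ≡ framed (run x) t (run y) ++ [ 𝟏 ]
  Φ-∷-∷ʳ x t y = begin
    Φ (x ∷ t ++ [ y ])                          ≡⟨ Φ-∷ x (t ++ [ y ]) ⟩
    𝟎^ run x ++ 𝟏 ∷ Φ (t ++ [ y ])              ≡⟨ cong (λ v → 𝟎^ run x ++ 𝟏 ∷ v) (Φ-++ t [ y ]) ⟩
    𝟎^ run x ++ 𝟏 ∷ Φ t ++ Φ [ y ]              ≡⟨ cong (λ v → 𝟎^ run x ++ 𝟏 ∷ Φ t ++ v) (Φ-singleton y) ⟩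
    𝟎^ run x ++ 𝟏 ∷ Φ t ++ 𝟎^ run y ++ [ 𝟏 ]    ≡⟨ solve 4 (λ X T Y o → X ⊕ (o ⊕ (T ⊕ (Y ⊕ o))) ⊜ (X ⊕ (o ⊕ (T ⊕ Y))) ⊕ o) refl (𝟎^ run x) (Φ t) (𝟎^ run y) [ 𝟏 ] ⟩
    (𝟎^ run x ++ 𝟏 ∷ Φ t ++ 𝟎^ run y) ++ [ 𝟏 ]  ∎
    where open ≡-Reasoning

  framed-palindrome⁺ : ∀ {k t} → Palindrome t → Palindrome (framed k t k)
  framed-palindrome⁺ {k} {t} t-pal = trans (reverse-framed k t k) (cong (λ v → framed k v k) t-pal)

  framed-central : ∀ {i} X x t → Palindrome X →
                   Central (framed (run x) t (run x)) (framed i (X ++ (x ∷ t ++ [ x ]) ++ X) i)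
  framed-central {i} X x t X-pal = W , (begin
    𝟎^ i ++ 𝟏 ∷ Φ (X ++ (x ∷ t ++ [ x ]) ++ X) ++ 𝟎^ i     ≡⟨ cong (λ v → 𝟎^ i ++ 𝟏 ∷ v ++ 𝟎^ i) (trans (Φ-++ X _) (cong (Φ X ++_) (Φ-++ (x ∷ t ++ [ x ]) X))) ⟩
    𝟎^ i ++ 𝟏 ∷ (Φ X ++ Φ (x ∷ t ++ [ x ]) ++ Φ X) ++ 𝟎^ i ≡⟨ cong (λ v → 𝟎^ i ++ 𝟏 ∷ (Φ X ++ v ++ Φ X) ++ 𝟎^ i) (Φ-∷-∷ʳ x t x) ⟩
    𝟎^ i ++ 𝟏 ∷ (Φ X ++ (F ++ [ 𝟏 ]) ++ Φ X) ++ 𝟎^ i       ≡⟨ solve 4 (λ I o Y F → I ⊕ (o ⊕ ((Y ⊕ ((F ⊕ o) ⊕ Y)) ⊕ I)) ⊜ (I ⊕ (o ⊕ Y)) ⊕ (F ⊕ ((o ⊕ Y) ⊕ I))) refl (𝟎^ i) [ 𝟏 ] (Φ X) F ⟩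
    W ++ F ++ 𝟏 ∷ Φ X ++ 𝟎^ i                              ≡⟨ cong (λ v → W ++ F ++ 𝟏 ∷ Φ v ++ 𝟎^ i) X-pal ⟨
    W ++ F ++ 𝟏 ∷ Φ (reverse X) ++ 𝟎^ i                    ≡⟨ cong (λ v → W ++ F ++ v) reverse-W ⟨
    W ++ F ++ reverse W                                    ∎)
    where
    open ≡-Reasoning
    W = 𝟎^ i ++ 𝟏 ∷ Φ X
    F = framed (run x) t (run x)
    reverse-W : reverse W ≡ 𝟏 ∷ Φ (reverse X) ++ 𝟎^ i
    reverse-W = trans (cong (λ v → reverse (𝟎^ i ++ 𝟏 ∷ v)) (sym (++-identityʳ (Φ X)))) (reverse-framed i X 0)

  module _ (a≢b : a ≢ b) where

    run-injective : ∀ {x y} → run x ≡ run y → x ≡ y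
    run-injective {𝟎} {𝟎} _ = refl
    run-injective {𝟏} {𝟏} _ = refl
    run-injective {𝟎} {𝟏} a≡b = ⊥-elim (a≢b a≡b)
    run-injective {𝟏} {𝟎} b≡a = ⊥-elim (a≢b (sym b≡a))

    Φ-injective : ∀ X Y → Φ X ≡ Φ Y → X ≡ Y
    Φ-injective []      []      _  = refl
    Φ-injective []      (y ∷ Y) eq = ⊥-elim (𝟎^-𝟏≢[] _ _ (trans (sym (Φ-∷ y Y)) (sym eq)))
    Φ-injective (x ∷ X) []      eq = ⊥-elim (𝟎^-𝟏≢[] _ _ (trans (sym (Φ-∷ x X)) eq))
    Φ-injective (x ∷ X) (y ∷ Y) eq with 𝟎^-𝟏-injective (trans (sym (Φ-∷ x X)) (trans eq (Φ-∷ y Y)))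
    ... | run≡ , Φ≡ = cong₂ _∷_ (run-injective run≡) (Φ-injective X Y Φ≡)

    framed-palindrome⁻ : ∀ {i t j} → Palindrome (framed i t j) → j ≡ i × Palindrome t
    framed-palindrome⁻ {i} {t} {j} pal with 𝟎^-𝟏-injective (trans (sym (reverse-framed i t j)) pal)
    ... | refl , Φ≡ = refl , Φ-injective (reverse t) t (++-cancelʳ (𝟎^ i) (Φ (reverse t)) (Φ t) Φ≡)

module Language (a b : ℕ) (3≤a : 3 ≤ a) where

  open Morphism a b

  Φ^ : ℕ → Word → Word
  Φ^ = φ^ a b

  u⟨_⟩ : ℕ → Word
  u⟨ n ⟩ = Φ^ n [ 𝟎 ]

  Factor : Word → Set
  Factor w = ∃ λ n → w ⊑ u⟨ n ⟩

  Φ^-++ : ∀ n X Y → Φ^ n (X ++ Y) ≡ Φ^ n X ++ Φ^ n Y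
  Φ^-++ zero    X Y = refl
  Φ^-++ (suc n) X Y = trans (cong Φ (Φ^-++ n X Y)) (Φ-++ (Φ^ n X) (Φ^ n Y))

  Φ^-Φ : ∀ n X → Φ^ n (Φ X) ≡ Φ (Φ^ n X)
  Φ^-Φ zero    X = refl
  Φ^-Φ (suc n) X = cong Φ (Φ^-Φ n X)

  W₀ : Word
  W₀ = 𝟎^ (a ∸ 3) ++ [ 𝟏 ]

  -- φ(0) = 0^a 1 begins with 000, so u⟨n+1⟩ = φⁿ(φ(0)) begins with three copies of u⟨n⟩
  u⟨suc⟩ : ∀ n → u⟨ suc n ⟩ ≡ u⟨ n ⟩ ++ u⟨ n ⟩ ++ u⟨ n ⟩ ++ Φ^ n W₀
  u⟨suc⟩ n = begin
    Φ (Φ^ n [ 𝟎 ])                     ≡⟨ Φ^-Φ n [ 𝟎 ] ⟨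
    Φ^ n (Φ [ 𝟎 ])                     ≡⟨ cong (Φ^ n) Φ[𝟎] ⟩
    Φ^ n (𝟎 ∷ 𝟎 ∷ 𝟎 ∷ W₀)              ≡⟨ Φ^-++ n [ 𝟎 ] (𝟎 ∷ 𝟎 ∷ W₀) ⟩
    u⟨ n ⟩ ++ Φ^ n (𝟎 ∷ 𝟎 ∷ W₀)        ≡⟨ cong (u⟨ n ⟩ ++_) (Φ^-++ n [ 𝟎 ] (𝟎 ∷ W₀)) ⟩
    u⟨ n ⟩ ++ u⟨ n ⟩ ++ Φ^ n (𝟎 ∷ W₀)  ≡⟨ cong (λ v → u⟨ n ⟩ ++ u⟨ n ⟩ ++ v) (Φ^-++ n [ 𝟎 ] W₀) ⟩
    u⟨ n ⟩ ++ u⟨ n ⟩ ++ u⟨ n ⟩ ++ Φ^ n W₀ ∎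
    where
    open ≡-Reasoning
    Φ[𝟎] : Φ [ 𝟎 ] ≡ 𝟎 ∷ 𝟎 ∷ 𝟎 ∷ W₀
    Φ[𝟎] = trans (Φ-singleton 𝟎) (cong (λ m → 𝟎^ m ++ [ 𝟏 ]) (sym (m+[n∸m]≡n 3≤a)))

  u⟨⟩-head : ∀ n → ∃ λ T → u⟨ n ⟩ ≡ 𝟎 ∷ T
  u⟨⟩-head zero    = [] , refl
  u⟨⟩-head (suc n) with u⟨⟩-head n
  ... | T , u≡ = T ++ _ , trans (u⟨suc⟩ n) (cong (_++ u⟨ n ⟩ ++ u⟨ n ⟩ ++ Φ^ n W₀) u≡)

  length-u⟨⟩ : ∀ n → n < length u⟨ n ⟩
  length-u⟨⟩ zero    = s≤s z≤n
  length-u⟨⟩ (suc n) = begin-strict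
    suc n               <⟨ +-mono-≤ (≤-trans (s≤s z≤n) ih) ih ⟩
    ℓ + ℓ               ≤⟨ +-monoʳ-≤ ℓ (subst (ℓ ≤_) (sym (length-++ u⟨ n ⟩)) (m≤m+n ℓ _)) ⟩
    ℓ + length (u⟨ n ⟩ ++ _) ≡⟨ length-++ u⟨ n ⟩ ⟨
    length (u⟨ n ⟩ ++ u⟨ n ⟩ ++ _) ≡⟨ cong length (u⟨suc⟩ n) ⟨
    length u⟨ suc n ⟩   ∎
    where
    open ≤-Reasoning
    ℓ = length u⟨ n ⟩
    ih = length-u⟨⟩ n

  u⟨⟩-prefix : ∀ d n → Prefix u⟨ n ⟩ u⟨ d + n ⟩
  u⟨⟩-prefix zero    n = [] , sym (++-identityʳ u⟨ n ⟩)
  u⟨⟩-prefix (suc d) n = prefix-trans (u⟨⟩-prefix d n) (_ , u⟨suc⟩ (d + n))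

  nth-u⟨⟩ : ∀ n {i} → i < length u⟨ n ⟩ → nth u⟨ n ⟩ i ≡ u a b i
  nth-u⟨⟩ n {i} i< = begin
    nth u⟨ n ⟩ i              ≡⟨ nth-prefix i< (u⟨⟩-prefix (suc i) n) ⟨
    nth u⟨ suc i + n ⟩ i      ≡⟨ cong (λ m → nth u⟨ m ⟩ i) (+-comm (suc i) n) ⟩
    nth u⟨ n + suc i ⟩ i      ≡⟨ nth-prefix (≤-trans (n≤1+n _) (length-u⟨⟩ (suc i))) (u⟨⟩-prefix n (suc i)) ⟩
    nth u⟨ suc i ⟩ i          ∎
    where open ≡-Reasoning

  factor⇒inLang : ∀ {w} → Factor w → InLang a b w
  factor⇒inLang {w} (n , L , R , u≡) = length L , λ j j< →
    let same , bound = ⊑⇒occurs L w R j< in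
    trans same (trans (cong (λ v → nth v (length L + j)) (sym u≡))
                      (nth-u⟨⟩ n (subst (length L + j <_) (cong length (sym u≡)) bound)))

  inLang⇒factor : ∀ {w} → InLang a b w → Factor w
  inLang⇒factor {w} (i , occ) = N , occurs⇒⊑ u⟨ N ⟩ i w fits
    (λ j j< → trans (occ j j<) (sym (nth-u⟨⟩ N (<-≤-trans (+-monoʳ-< i j<) fits))))
    where
    N = i + length w
    fits : N ≤ length u⟨ N ⟩
    fits = <⇒≤ (length-u⟨⟩ N)

  factor-⊑ : ∀ {w v} → w ⊑ v → Factor v → Factor w
  factor-⊑ w⊑v (n , v⊑u) = n , ⊑-trans w⊑v v⊑u

  factor-Φ : ∀ {w} → Factor w → Factor (Φ w)
  factor-Φ (n , w⊑u) = suc n , Φ-⊑ w⊑u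

  ⊑-u⟨suc⟩ : ∀ {w n} → w ⊑ u⟨ n ⟩ → w ⊑ u⟨ suc n ⟩
  ⊑-u⟨suc⟩ {n = n} w⊑u = ⊑-trans w⊑u ([] , _ , u⟨suc⟩ n)

  -- use the occurrence inside the middle copy of u⟨n⟩ in u⟨n+1⟩
  factor-extend : ∀ {w} → Factor w → ∃₂ λ c d → Factor (c ∷ w ++ [ d ])
  factor-extend {w} (n , L , R , u≡) with u⟨⟩-head n
  ... | T , head≡ with inner-⊑ 𝟎 (T ++ L) w R 𝟎 (T ++ Φ^ n W₀)
  ...   | c , d , occ = c , d , suc n , subst (c ∷ w ++ [ d ] ⊑_) (begin
    (𝟎 ∷ T ++ L) ++ w ++ R ++ 𝟎 ∷ T ++ S          ≡⟨ solve 5 (λ H L w R S → (H ⊕ L) ⊕ (w ⊕ (R ⊕ (H ⊕ S))) ⊜ H ⊕ ((L ⊕ (w ⊕ R)) ⊕ (H ⊕ S))) refl (𝟎 ∷ T) L w R S ⟩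
    (𝟎 ∷ T) ++ (L ++ w ++ R) ++ (𝟎 ∷ T) ++ S      ≡⟨ cong₂ (λ h m → h ++ m ++ h ++ S) head≡ u≡ ⟨
    u⟨ n ⟩ ++ u⟨ n ⟩ ++ u⟨ n ⟩ ++ S               ≡⟨ u⟨suc⟩ n ⟨
    u⟨ suc n ⟩                                    ∎) occ
    where
    open ≡-Reasoning
    S = Φ^ n W₀

module Palindromes (a b : ℕ) (b<a : b < a) (3≤a : 3 ≤ a) where

  open Morphism a b
  open Language a b 3≤a

  b≤a : b ≤ a
  b≤a = <⇒≤ b<a

  a≢b : a ≢ b
  a≢b a≡b = <⇒≢ b<a (sym a≡b)

  run≤a : ∀ x → run x ≤ a
  run≤a 𝟎 = ≤-refl
  run≤a 𝟏 = b≤a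

  b≤run : ∀ x → b ≤ run x
  b≤run 𝟎 = b≤a
  b≤run 𝟏 = ≤-refl

  b<run⇒𝟎 : ∀ {x} → b < run x → x ≡ 𝟎
  b<run⇒𝟎 {𝟎} _   = refl
  b<run⇒𝟎 {𝟏} b<b = ⊥-elim (<-irrefl refl b<b)

  -- cut φ(Q) after the last 1 before the run, which then begins a block φ(x)
  𝟎^-⊑Φ-≤ : ∀ {i Q} → 𝟎^ i ⊑ Φ Q → i ≤ a
  𝟎^-⊑Φ-≤ {zero}        _             = z≤n
  𝟎^-⊑Φ-≤ {suc i} {Q} (L , R , eq) with trailingZeros L
  ... | _·𝟎^_ {s} s-end l with Φ-cut Q s-end (trans eq (merge-zeros s l (suc i) R))
  ...   | _ , C , _ , _ , ΦC with 𝟎^-prefix-Φ C (≤-trans (s≤s z≤n) (m≤n+m (suc i) l)) ΦC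
  ...     | x , _ , _ , l+i≤run = ≤-trans (m≤n+m (suc i) l) (≤-trans l+i≤run (run≤a x))

  zero-run-≤ : ∀ {i} → Factor (𝟎^ i) → i ≤ a
  zero-run-≤ (n , occ) = 𝟎^-⊑Φ-≤ {Q = u⟨ n ⟩} (⊑-u⟨suc⟩ {n = n} occ)

  bordered-image : ∀ {w} → Factor w → Factor (𝟏 ∷ Φ w ++ 𝟎^ b)
  bordered-image {w} F with factor-extend F
  ... | c , d , F′ = factor-⊑ (𝟎^ run c , 𝟎^ (run d ∸ b) ++ [ 𝟏 ] , (begin
    Φ (c ∷ w ++ [ d ])                                     ≡⟨ Φ-∷-∷ʳ c w d ⟩
    (𝟎^ run c ++ 𝟏 ∷ Φ w ++ 𝟎^ run d) ++ [ 𝟏 ]             ≡⟨ cong (λ z → (𝟎^ run c ++ 𝟏 ∷ Φ w ++ z) ++ [ 𝟏 ]) (𝟎^-split (b≤run d)) ⟩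
    (𝟎^ run c ++ 𝟏 ∷ Φ w ++ 𝟎^ b ++ D) ++ [ 𝟏 ]            ≡⟨ solve 5 (λ C o W B D → (C ⊕ (o ⊕ (W ⊕ (B ⊕ D)))) ⊕ o ⊜ C ⊕ ((o ⊕ (W ⊕ B)) ⊕ (D ⊕ o))) refl (𝟎^ run c) [ 𝟏 ] (Φ w) (𝟎^ b) D ⟩
    𝟎^ run c ++ (𝟏 ∷ Φ w ++ 𝟎^ b) ++ D ++ [ 𝟏 ]            ∎)) (factor-Φ F′)
    where
    open ≡-Reasoning
    D = 𝟎^ (run d ∸ b)

  𝟏𝟎^a : Factor (𝟏 ∷ 𝟎^ a)
  𝟏𝟎^a = factor-⊑ ([] , 𝟏 ∷ 𝟎^ b , cong (𝟏 ∷_) (trans (cong (_++ 𝟎^ b) (Φ-singleton 𝟎)) (++-assoc (𝟎^ a) [ 𝟏 ] (𝟎^ b))))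
    (bordered-image (0 , [] , [] , refl))

  image-𝟏 : ∀ {s} → Factor (𝟏 ∷ s) → Factor (𝟏 ∷ framed b s b)
  image-𝟏 {s} F = subst (λ v → Factor (𝟏 ∷ v))
    (trans (cong (_++ 𝟎^ b) (Φ-∷ 𝟏 s)) (++-assoc (𝟎^ b) (𝟏 ∷ Φ s) (𝟎^ b))) (bordered-image F)

  image-𝟎 : ∀ {t} → Factor (𝟎 ∷ t ++ [ 𝟎 ]) → Factor (𝟏 ∷ framed a t a)
  image-𝟎 {t} F = factor-⊑ ([] , 𝟏 ∷ 𝟎^ b ,
    cong (𝟏 ∷_) (trans (cong (_++ 𝟎^ b) (Φ-∷-∷ʳ 𝟎 t 𝟎)) (++-assoc (framed a t a) [ 𝟏 ] (𝟎^ b)))) (bordered-image F)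

  -- framed k t k occurs in φ(Q) inside the image of an occurrence x t y in Q, with
  -- k ≤ run x and x = y = 0 once k > b
  record Desubstitution (Q : Word) (k : ℕ) (t : Word) : Set where
    field
      t-palindrome : Palindrome t
      t⊑Q          : t ⊑ Q
      k≤a          : k ≤ a
      𝟎t𝟎⊑Q        : b < k → 𝟎 ∷ t ++ [ 𝟎 ] ⊑ Q

  𝟎-neighbours : ∀ A x t y C → b < run x → b < run y → 𝟎 ∷ t ++ [ 𝟎 ] ⊑ A ++ x ∷ t ++ y ∷ C
  𝟎-neighbours A x t y C b<x b<y with b<run⇒𝟎 b<x | b<run⇒𝟎 b<y
  ... | refl | refl = A , C , cong (λ v → A ++ 𝟎 ∷ v) (sym (++-assoc t [ 𝟎 ] C))

  desubstitute : ∀ {Q} k M → 𝟎^ k ++ 𝟏 ∷ M ⊑ Φ Q → Palindrome (𝟎^ k ++ 𝟏 ∷ M) →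
                 ∃ λ t → 𝟎^ k ++ 𝟏 ∷ M ≡ framed k t k × Desubstitution Q k t
  desubstitute {Q} k M (L , R , eq) pal with trailingZeros L | trailingZeros M
  ... | _·𝟎^_ {s₁} s₁-end l | _·𝟎^_ {s} s-end j
    with Φ-cut Q s₁-end (trans eq (trans (cong ((s₁ ++ 𝟎^ l) ++_) (++-assoc (𝟎^ k) (𝟏 ∷ s ++ 𝟎^ j) R))
                                    (merge-zeros s₁ l k (𝟏 ∷ (s ++ 𝟎^ j) ++ R))))
  ... | A , C₀ , refl , _ , ΦC₀ with Φ-block C₀ ΦC₀
  ... | x , C₁ , refl , run-x , ΦC₁ with Φ-cut C₁ s-end (trans ΦC₁ (++-assoc s (𝟎^ j) R))
  ... | t , C , refl , refl , ΦC with framed-palindrome⁻ a≢b {k} {t} {j} pal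
  ... | refl , t-pal = t , refl , record
    { t-palindrome = t-pal
    ; t⊑Q          = A ++ [ x ] , C , sym (++-assoc A [ x ] (t ++ C))
    ; k≤a          = ≤-trans k≤run (run≤a x)
    ; 𝟎t𝟎⊑Q        = 𝟎t𝟎⊑
    }
    where
    k≤run : k ≤ run x
    k≤run = subst (k ≤_) (sym run-x) (m≤n+m k l)
    𝟎t𝟎⊑ : b < k → 𝟎 ∷ t ++ [ 𝟎 ] ⊑ A ++ x ∷ t ++ C
    𝟎t𝟎⊑ b<k with 𝟎^-prefix-Φ C (≤-trans (s≤s z≤n) b<k) ΦC
    ... | y , C′ , C≡ , k≤run-y = subst (λ v → 𝟎 ∷ t ++ [ 𝟎 ] ⊑ A ++ x ∷ t ++ v) (sym C≡)
      (𝟎-neighbours A x t y C′ (<-≤-trans b<k k≤run) (<-≤-trans b<k k≤run-y))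

  open Desubstitution

  BorderedBy𝟏 : Word → Set
  BorderedBy𝟏 r = ∃ λ m → Factor (𝟏 ∷ 𝟎^ m ++ r ++ 𝟎^ m)

  zeros-bordered : ∀ {i} → Factor (𝟎^ i) → BorderedBy𝟏 (𝟎^ i)
  zeros-bordered {i} F = 0 , factor-⊑ ([] , 𝟎^ (a ∸ i) , cong (𝟏 ∷_) 𝟎^a≡) 𝟏𝟎^a
    where
    𝟎^a≡ : 𝟎^ a ≡ (𝟎^ i ++ []) ++ 𝟎^ (a ∸ i)
    𝟎^a≡ = trans (𝟎^-split (zero-run-≤ F)) (cong (_++ 𝟎^ (a ∸ i)) (sym (++-identityʳ (𝟎^ i))))

  framed-factor : ∀ {n k t} → Desubstitution u⟨ n ⟩ k t → BorderedBy𝟏 t →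
                  ∃ λ j → k ≤ j × b ≤ j × Factor (𝟏 ∷ framed j t j)
  framed-factor {t = t} D (suc m , F) = a , k≤a D , b≤a , image-𝟎 (factor-⊑ (𝟏 ∷ 𝟎^ m , 𝟎^ m , 𝟎t𝟎-inside) F)
    where
    𝟎t𝟎-inside : 𝟏 ∷ 𝟎^ suc m ++ t ++ 𝟎^ suc m ≡ (𝟏 ∷ 𝟎^ m) ++ (𝟎 ∷ t ++ [ 𝟎 ]) ++ 𝟎^ m
    𝟎t𝟎-inside = cong (𝟏 ∷_) (trans (cong (_++ t ++ 𝟎^ suc m) (𝟎^-suc m))
      (solve 3 (λ Z o t → (Z ⊕ o) ⊕ (t ⊕ (o ⊕ Z)) ⊜ Z ⊕ ((o ⊕ (t ⊕ o)) ⊕ Z)) refl (𝟎^ m) [ 𝟎 ] t))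
  framed-factor {n} {k} {t} D (zero , F) with k ≤? b
  ... | yes k≤b = b , k≤b , ≤-refl , image-𝟏 (subst (λ v → Factor (𝟏 ∷ v)) (++-identityʳ t) F)
  ... | no  k≰b = a , k≤a D , b≤a , image-𝟎 (n , 𝟎t𝟎⊑Q D (≰⇒> k≰b))

  bordered-framed : ∀ {k j t} → k ≤ j → Factor (𝟏 ∷ framed j t j) → BorderedBy𝟏 (framed k t k)
  bordered-framed {k} {j} {t} k≤j F = j ∸ k , subst (λ v → Factor (𝟏 ∷ v)) (𝟎^-wrap (𝟏 ∷ Φ t) k≤j) F

  palindrome-bordered : ∀ n r → r ⊑ u⟨ n ⟩ → Palindrome r → BorderedBy𝟏 r
  palindrome-bordered n r occ pal with leadingZeros r
  ... | all-zeros i = zeros-bordered (n , occ)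
  palindrome-bordered zero    _ occ pal | zeros-𝟏 k M = ⊥-elim (𝟏∉𝟎^ 1 (∈-⊑ (∈-++⁺ʳ (𝟎^ k) (here refl)) occ))
  palindrome-bordered (suc n) _ occ pal | zeros-𝟏 k M with desubstitute k M occ pal
  ... | t , r≡ , D with framed-factor {n} D (palindrome-bordered n t (t⊑Q D) (t-palindrome D))
  ...   | j , k≤j , _ , F = subst BorderedBy𝟏 (sym r≡) (bordered-framed {t = t} k≤j F)

  CentralExtension : Word → Set
  CentralExtension p = ∃ λ q → InLang a b q × Palindrome q × CentralFactor a b p q × Prefix (𝟎^ b ++ [ 𝟏 ]) q

  central-extension-of : ∀ {p q} → Palindrome p → Central p q → Factor q → Prefix (𝟎^ b ++ [ 𝟏 ]) q →
                         CentralExtension p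
  central-extension-of {p} p-pal (w , q≡) F prefix =
    _ , factor⇒inLang F , central-palindrome p-pal (w , q≡) ,
    (w , factor⇒inLang (factor-⊑ {w} ([] , p ++ reverse w , q≡) F) , q≡) , prefix

  framed-prefix : ∀ s j → Prefix (𝟎^ b ++ [ 𝟏 ]) (framed b s j)
  framed-prefix s j = Φ s ++ 𝟎^ j , sym (++-assoc (𝟎^ b) [ 𝟏 ] (Φ s ++ 𝟎^ j))

  central-extension : ∀ {n k t} → Desubstitution u⟨ n ⟩ k t → CentralExtension (framed k t k)
  central-extension {n} {k} {t} D with k ≤? b
  ... | yes k≤b with framed-factor {n} D (palindrome-bordered n t (t⊑Q D) (t-palindrome D))
  ...   | j , _ , b≤j , F =
    central-extension-of (framed-palindrome⁺ (t-palindrome D)) (central-𝟎^ (𝟏 ∷ Φ t) k≤b)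
      (factor-⊑ (𝟏 ∷ 𝟎^ (j ∸ b) , 𝟎^ (j ∸ b) , cong (𝟏 ∷_) (𝟎^-wrap (𝟏 ∷ Φ t) b≤j)) F) (framed-prefix t b)
  central-extension {n} {k} {t} D | no k≰b
    with palindrome-bordered n (𝟎 ∷ t ++ [ 𝟎 ]) (𝟎t𝟎⊑Q D (≰⇒> k≰b)) (central-palindrome (t-palindrome D) ([ 𝟎 ] , refl))
  ... | m , F =
    central-extension-of (framed-palindrome⁺ (t-palindrome D))
      (central-trans (central-𝟎^ (𝟏 ∷ Φ t) (k≤a D)) (framed-central (𝟎^ m) 𝟎 t (reverse-𝟎^ m)))
      (factor-⊑ (⊑-∷ 𝟏 (framed b s b)) (image-𝟏 F)) (framed-prefix s b)
    where
    s = 𝟎^ m ++ (𝟎 ∷ t ++ [ 𝟎 ]) ++ 𝟎^ m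

lemma5p2 : (a b : ℕ) → 1 ≤ b → b + 1 < a →
    (p : Word) → InLang a b p → Palindrome p → 𝟏 ∈ p →
    ∃ λ q → InLang a b q × Palindrome q × CentralFactor a b p q
    × Prefix (replicate b 𝟎 ++ (𝟏 ∷ [])) q
lemma5p2 a b 1≤b b+1<a p p∈L p-pal 𝟏∈p = extension (leadingZeros p) 𝟏∈p p-pal (inLang⇒factor p∈L)
  where
  b+2≤a : 2 + b ≤ a
  b+2≤a = subst (_< a) (+-comm b 1) b+1<a
  b<a : b < a
  b<a = ≤-trans (n≤1+n (suc b)) b+2≤a
  3≤a : 3 ≤ a
  3≤a = ≤-trans (s≤s (s≤s 1≤b)) b+2≤a
  open Language a b 3≤a
  open Palindromes a b b<a 3≤a
  extension : ∀ {p} → LeadingZeros p → 𝟏 ∈ p → Palindrome p → Factor p → CentralExtension p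
  extension (all-zeros i)  𝟏∈𝟎^i _     _            = ⊥-elim (𝟏∉𝟎^ i 𝟏∈𝟎^i)
  extension (zeros-𝟏 k M) _      p-pal (n , p⊑uₙ) with desubstitute {u⟨ n ⟩} k M (⊑-u⟨suc⟩ {n = n} p⊑uₙ) p-pal
  ... | t , p≡ , D = subst CentralExtension (sym p≡) (central-extension {n} D)
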